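{- Let $G$ be a finite connected graph of order $n$ with minimum degree $\delta(G)$. If \[ \delta(G) \geq \Big\lfloor \frac{n+2}{4} \Big\rfloor , \] then $G^2$ is maximally edge-connected, i.e. $\lambda(G^2)=\delta(G^2)$.
   Context: All graphs are finite and simple. The square $G^2$ of a graph $G$ is the graph on the vertex set $V(G)$ in which two distinct vertices are adjacent if and only if their distance in $G$ is at most $2$. The edge-connectivity $\lambda(G)$ is the minimum number of edges whose removal disconnects $G$; $\delta(G)$ is the minimum degree. A graph is maximally edge-connected if its edge-connectivity equals its minimum degree. -}

module Defs where

open import Data.Nat using (ℕ; zero; suc; _+_; _⊔_; _⊓_; _≤_)
open import Data.Fin using (Fin; zero; suc; _<?_)
open import Data.Fin.Properties using (_≟_)
open import Data.Bool using (Bool; true; false; _∧_; _∨_; not; T)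
open import Data.Product using (Σ; _×_; ∃)
open import Relation.Nullary using (¬_; does)
open import Relation.Binary.PropositionalEquality using (_≡_)

anyFin : ∀ {n} → (Fin n → Bool) → Bool
anyFin {zero}  f = false
anyFin {suc n} f = f zero ∨ anyFin (λ i → f (suc i))

countFin : ∀ {n} → (Fin n → Bool) → ℕ
countFin {zero}  f = 0
countFin {suc n} f = (if' (f zero)) + countFin (λ i → f (suc i))
  where
  if' : Bool → ℕ
  if' true  = 1
  if' false = 0

minFin : ∀ {m} → (Fin (suc m) → ℕ) → ℕ
minFin {zero}  f = f zero
minFin {suc m} f = f zero ⊓ minFin (λ i → f (suc i))

record Graph (n : ℕ) : Set where
  field
    adj     : Fin n → Fin n → Bool
    sym     : ∀ u v → adj u v ≡ adj v u
    irrefl  : ∀ v → adj v v ≡ false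
open Graph public

Adj : ∀ {n} → Graph n → Fin n → Fin n → Set
Adj G u v = T (adj G u v)

degree : ∀ {n} → Graph n → Fin n → ℕ
degree G v = countFin (adj G v)

minDegree : ∀ {m} → Graph (suc m) → ℕ
minDegree G = minFin (degree G)

data Reachable {n} (G : Graph n) : Fin n → Fin n → Set where
  here : ∀ {v} → Reachable G v v
  step : ∀ {u w v} → Adj G u w → Reachable G w v → Reachable G u v

Connected : ∀ {n} → Graph n → Set
Connected G = ∀ u v → Reachable G u v

sqAdj : ∀ {n} → Graph n → Fin n → Fin n → Bool
sqAdj G u v = not (does (u ≟ v)) ∧ (adj G u v ∨ anyFin (λ w → adj G u w ∧ adj G w v))

open import Relation.Binary.PropositionalEquality using (refl; cong; cong₂; trans)
open import Data.Bool.Properties using (∧-comm; ∨-comm)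

private
  ≟-sym : ∀ {n} (u v : Fin n) → does (u ≟ v) ≡ does (v ≟ u)
  ≟-sym u v with u ≟ v | v ≟ u
  ... | Relation.Nullary.yes _ | Relation.Nullary.yes _ = refl
  ... | Relation.Nullary.no _  | Relation.Nullary.no _  = refl
  ... | Relation.Nullary.yes p | Relation.Nullary.no q  = Data.Empty.⊥-elim (q (Relation.Binary.PropositionalEquality.sym p))
    where import Data.Empty
  ... | Relation.Nullary.no p  | Relation.Nullary.yes q = Data.Empty.⊥-elim (p (Relation.Binary.PropositionalEquality.sym q))
    where import Data.Empty

  anyFin-cong : ∀ {n} (f g : Fin n → Bool) → (∀ i → f i ≡ g i) → anyFin f ≡ anyFin g
  anyFin-cong {zero}  f g e = refl
  anyFin-cong {suc n} f g e = cong₂ _∨_ (e zero) (anyFin-cong _ _ (λ i → e (suc i)))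

  sqAdj-sym : ∀ {n} (G : Graph n) u v → sqAdj G u v ≡ sqAdj G v u
  sqAdj-sym G u v = cong₂ _∧_ (cong not (≟-sym u v))
    (cong₂ _∨_ (sym G u v)
      (anyFin-cong _ _ (λ w → trans (cong₂ _∧_ (sym G u w) (sym G w v)) (∧-comm (adj G w u) (adj G v w)))))

  sqAdj-irrefl : ∀ {n} (G : Graph n) v → sqAdj G v v ≡ false
  sqAdj-irrefl G v with v ≟ v
  ... | Relation.Nullary.yes _ = refl
  ... | Relation.Nullary.no ¬p = Data.Empty.⊥-elim (¬p refl)
    where import Data.Empty

square : ∀ {n} → Graph n → Graph n
square G = record { adj = sqAdj G ; sym = sqAdj-sym G ; irrefl = sqAdj-irrefl G }

record EdgeSet {n} (G : Graph n) : Set where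
  field
    mem    : Fin n → Fin n → Bool
    memSym : ∀ u v → mem u v ≡ mem v u
    sub    : ∀ u v → T (mem u v) → T (adj G u v)
open EdgeSet public

sumFin : ∀ {k} → (Fin k → ℕ) → ℕ
sumFin {zero}  f = 0
sumFin {suc k} f = f zero + sumFin (λ i → f (suc i))

edgeCount : ∀ {n} {G : Graph n} → EdgeSet G → ℕ
edgeCount F = sumFin (λ u → countFin (λ v → does (u <? v) ∧ mem F u v))

private
  del-sym : ∀ {n} (G : Graph n) (F : EdgeSet G) u v →
            adj G u v ∧ not (mem F u v) ≡ adj G v u ∧ not (mem F v u)
  del-sym G F u v = cong₂ _∧_ (sym G u v) (cong not (memSym F u v))

  del-irrefl : ∀ {n} (G : Graph n) (F : EdgeSet G) v → adj G v v ∧ not (mem F v v) ≡ false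
  del-irrefl G F v rewrite irrefl G v = refl

_─_ : ∀ {n} (G : Graph n) → EdgeSet G → Graph n
G ─ F = record { adj = λ u v → adj G u v ∧ not (mem F u v)
               ; sym = del-sym G F ; irrefl = del-irrefl G F }

-- G is maximally edge-connected: λ(G) = δ(G), i.e. every set of edges whose
-- removal disconnects G has at least δ(G) edges, and some such set has exactly δ(G) edges
-- (the latter only for order ≥ 2; for the one-vertex graph λ = δ = 0 by convention).
MaximallyEdgeConnected : ∀ {m} → Graph (suc m) → Set
MaximallyEdgeConnected {m} G =
  (∀ (F : EdgeSet G) → ¬ Connected (G ─ F) → minDegree G ≤ edgeCount F)
  × (1 ≤ m → Σ (EdgeSet G) λ F → ¬ Connected (G ─ F) × edgeCount F ≡ minDegree G)

-- Suppose fewer than δ(G²) edges F disconnect G², let P be the vertex set of a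
-- component of G² − F and Q its complement; all G²-edges between P and Q lie in F.
-- If every vertex of P had a G²-neighbour in Q, each would have at least
-- max(δ(G²) + 1 − |P|, 1) of them, giving at least δ(G²) cut edges; so some vertex of P
-- has its whole G²-neighbourhood in P, and |P| > δ(G²). The same holds for Q, hence
-- n ≥ 2δ(G²) + 2. A walk in G between such interior vertices of P and Q, with its
-- shortcuts removed, contains an edge xy across the cut together with a neighbour
-- x′ ≠ y of x and a neighbour y′ of y at distance two from x, exactly one of x′, y′
-- lying in P. Counting the G²-edges this configuration forces across the cut gives
-- 2δ(G) ≤ |F| + 1 ≤ δ(G²),
-- so n ≥ 4δ(G) + 2, contradicting δ(G) ≥ ⌊(n + 2)/4⌋. Conversely, the G²-edges at a
-- vertex of minimum degree disconnect G².

module Submission where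

open import Defs renaming (sym to adj-sym)
open import Data.Nat.Properties as ℕ hiding (_≟_; <-cmp; <-asym; suc-injective; _<?_)
open import Algebra.Properties.Semiring.Sum ℕ.+-*-semiring
  using (sum; ∑-distrib-+; ∑-comm; sum-cong-≗; sum-replicate-zero; *-distribʳ-sum)
open import Algebra.Properties.CommutativeSemigroup ℕ.+-commutativeSemigroup using (xy∙z≈xz∙y)
open import Data.Bool using (Bool; true; false; _∧_; _∨_; not)
open import Data.Bool.Properties
  using (∧-conicalˡ; ∧-conicalʳ; ∧-zeroʳ; ∧-identityʳ; ∨-comm; ∨-zeroʳ; ¬-not; not-¬; T-≡)
  renaming (_≟_ to _≟ᴮ_)
open import Data.Empty using (⊥; ⊥-elim)
open import Data.Fin using (Fin; zero; suc; _<?_) renaming (_<_ to _<ᶠ_)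
open import Data.Fin.Properties using (_≟_; <-cmp; <-asym; suc-injective; any?; all?; ¬∀⟶∃¬)
open import Data.Nat
  using (ℕ; zero; suc; _+_; _*_; _∸_; _⊔_; _≤_; _<_; _≤?_; _/_; _%_; z≤n; s≤s; >-nonZero)
  renaming (_≟_ to _≟ℕ_)
open import Data.Nat.DivMod using (m%n<n; m≡m%n+[m/n]*n)
open import Data.Nat.Tactic.RingSolver using (solve-∀)
open import Data.Product using (Σ; ∃; ∃₂; _×_; _,_; proj₁; proj₂)
open import Data.Sum using (_⊎_; inj₁; inj₂)
open import Data.Unit using (⊤; tt)
open import Function using (_∘_; Equivalence)
open import Relation.Binary using (tri<; tri≈; tri>)
open import Relation.Binary.PropositionalEquality
open import Relation.Nullary using (¬_; Dec; yes; no; does)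
open import Relation.Nullary.Decidable using (_×-dec_; dec-true; dec-false)

-- Sets of vertices are Boolean predicates on Fin n, counted through the Iverson bracket ⟦_⟧.
⟦_⟧ : Bool → ℕ
⟦ true ⟧  = 1
⟦ false ⟧ = 0

count : ∀ {n} → (Fin n → Bool) → ℕ
count p = sum (λ i → ⟦ p i ⟧)

sumFin≡sum : ∀ {n} (f : Fin n → ℕ) → sumFin f ≡ sum f
sumFin≡sum {zero}  f = refl
sumFin≡sum {suc n} f = cong (f zero +_) (sumFin≡sum (f ∘ suc))

countFin≡count : ∀ {n} (p : Fin n → Bool) → countFin p ≡ count p
countFin≡count {zero}  p = refl
countFin≡count {suc n} p with p zero
... | true  = cong suc (countFin≡count (p ∘ suc))
... | false = countFin≡count (p ∘ suc)

sum-mono-≤ : ∀ {n} {f g : Fin n → ℕ} → (∀ i → f i ≤ g i) → sum f ≤ sum g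
sum-mono-≤ {zero}  f≤g = z≤n
sum-mono-≤ {suc n} f≤g = +-mono-≤ (f≤g zero) (sum-mono-≤ (f≤g ∘ suc))

≤-sum : ∀ {n} (f : Fin n → ℕ) i → f i ≤ sum f
≤-sum f zero    = m≤m+n _ _
≤-sum f (suc i) = ≤-trans (≤-sum (f ∘ suc) i) (m≤n+m _ (f zero))

sum-zero : ∀ {n} {f : Fin n → ℕ} → (∀ i → f i ≡ 0) → sum f ≡ 0
sum-zero {n} f≡0 = trans (sum-cong-≗ f≡0) (sum-replicate-zero n)

sum-concentrated : ∀ {n} (f : Fin n → ℕ) i → (∀ j → j ≢ i → f j ≡ 0) → sum f ≡ f i
sum-concentrated f zero    f≡0 =
  trans (cong (f zero +_) (sum-zero (λ j → f≡0 (suc j) λ ()))) (+-identityʳ (f zero))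
sum-concentrated f (suc i) f≡0 =
  cong₂ _+_ (f≡0 zero λ ()) (sum-concentrated (f ∘ suc) i (λ j j≢i → f≡0 (suc j) (j≢i ∘ suc-injective)))

sum-weighted : ∀ {n} (p : Fin n → Bool) c → sum (λ i → ⟦ p i ⟧ * c) ≡ count p * c
sum-weighted p c = sym (*-distribʳ-sum c (λ i → ⟦ p i ⟧))

count-mono : ∀ {n} {p q : Fin n → Bool} → (∀ i → p i ≡ true → q i ≡ true) → count p ≤ count q
count-mono {p = p} {q} p⇒q = sum-mono-≤ pointwise
  where
  pointwise : ∀ i → ⟦ p i ⟧ ≤ ⟦ q i ⟧
  pointwise i with p i in pᵢ
  ... | false = z≤n
  ... | true  rewrite p⇒q i pᵢ = ≤-refl

count-pos : ∀ {n} (p : Fin n → Bool) i → p i ≡ true → 1 ≤ count p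
count-pos p i pᵢ = subst (_≤ count p) (cong ⟦_⟧ pᵢ) (≤-sum (λ j → ⟦ p j ⟧) i)

count-split : ∀ {n} (p q : Fin n → Bool) → count p ≡ count (λ i → p i ∧ q i) + count (λ i → p i ∧ not (q i))
count-split p q =
  trans (sum-cong-≗ pointwise) (∑-distrib-+ (λ i → ⟦ p i ∧ q i ⟧) (λ i → ⟦ p i ∧ not (q i) ⟧))
  where
  pointwise : ∀ i → ⟦ p i ⟧ ≡ ⟦ p i ∧ q i ⟧ + ⟦ p i ∧ not (q i) ⟧
  pointwise i with p i | q i
  ... | true  | true  = refl
  ... | true  | false = refl
  ... | false | _     = refl

count-≟ : ∀ {n} (i : Fin n) → count (λ j → does (j ≟ i)) ≡ 1
count-≟ {suc n} zero    = cong suc (sum-zero {n} (λ _ → refl))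
count-≟ {suc n} (suc i) = count-≟ i

count-all : ∀ {n} → count {n} (λ _ → true) ≡ n
count-all {zero}  = refl
count-all {suc n} = cong suc (count-all {n})

count-≤ : ∀ {n} (p : Fin n → Bool) → count p ≤ n
count-≤ {n} p = subst (count p ≤_) (count-all {n}) (count-mono {n} {p} {λ _ → true} (λ _ _ → refl))

count-mono-< : ∀ {n} {p q : Fin n → Bool} i → (∀ j → p j ≡ true → q j ≡ true) →
               p i ≡ false → q i ≡ true → count p + 1 ≤ count q
count-mono-< {p = p} {q} i p⇒q pᵢ qᵢ = begin
  count p + 1                                             ≤⟨ +-mono-≤ (count-mono p⇒q′) (count-pos _ i q∧¬pᵢ) ⟩
  count (λ j → q j ∧ p j) + count (λ j → q j ∧ not (p j)) ≡⟨ count-split q p ⟨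
  count q                                                 ∎
  where
  open ≤-Reasoning
  p⇒q′ : ∀ j → p j ≡ true → q j ∧ p j ≡ true
  p⇒q′ j pⱼ = cong₂ _∧_ (p⇒q j pⱼ) pⱼ
  q∧¬pᵢ : q i ∧ not (p i) ≡ true
  q∧¬pᵢ = cong₂ _∧_ qᵢ (cong not pᵢ)

anyFin-witness : ∀ {n} (f : Fin n → Bool) i → f i ≡ true → anyFin f ≡ true
anyFin-witness f zero    fᵢ rewrite fᵢ = refl
anyFin-witness f (suc i) fᵢ rewrite anyFin-witness (f ∘ suc) i fᵢ = ∨-zeroʳ (f zero)

anyFin-elim : ∀ {n} (f : Fin n → Bool) → anyFin f ≡ true → ∃ λ i → f i ≡ true
anyFin-elim {suc n} f any-f with f zero in f₀
... | true  = zero , f₀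
... | false with anyFin-elim (f ∘ suc) any-f
...   | i , fᵢ = suc i , fᵢ

not-true : ∀ {b} → not b ≡ true → b ≡ false
not-true {false} _ = refl

not-false : ∀ {b} → not b ≡ false → b ≡ true
not-false {true} _ = refl

≟⇒≡ : ∀ {n} {u v : Fin n} → does (u ≟ v) ≡ true → u ≡ v
≟⇒≡ {u = u} {v} _ with u ≟ v
... | yes u≡v = u≡v

⟦∧⟧ : ∀ a b → ⟦ a ∧ b ⟧ ≡ ⟦ a ⟧ * ⟦ b ⟧
⟦∧⟧ true  b = sym (+-identityʳ ⟦ b ⟧)
⟦∧⟧ false b = refl

minFin-≤ : ∀ {m} (f : Fin (suc m) → ℕ) i → minFin f ≤ f i
minFin-≤ {zero}  f zero    = ≤-refl
minFin-≤ {suc m} f zero    = m⊓n≤m _ _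
minFin-≤ {suc m} f (suc i) = ≤-trans (m⊓n≤n _ _) (minFin-≤ (f ∘ suc) i)

minFin-attained : ∀ {m} (f : Fin (suc m) → ℕ) → ∃ λ i → minFin f ≡ f i
minFin-attained {zero}  f = zero , refl
minFin-attained {suc m} f with ⊓-sel (f zero) (minFin (f ∘ suc))
... | inj₁ min≡f₀ = zero , min≡f₀
... | inj₂ min≡rest with minFin-attained (f ∘ suc)
...   | i , eq = suc i , trans min≡rest eq

_<ᵇ_ : ∀ {n} → Fin n → Fin n → Bool
i <ᵇ j = does (i <? j)

order-split : ∀ {n} (f : Fin n → Fin n → ℕ) → (∀ i → f i i ≡ 0) →
              ∀ i j → f i j ≡ ⟦ i <ᵇ j ⟧ * f i j + ⟦ j <ᵇ i ⟧ * f i j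
order-split f fᵢᵢ≡0 i j = by-cases (i <? j) (j <? i)
  where
  by-cases : (i<?j : Dec (i <ᶠ j)) (j<?i : Dec (j <ᶠ i)) →
             f i j ≡ ⟦ does i<?j ⟧ * f i j + ⟦ does j<?i ⟧ * f i j
  by-cases (yes i<j) (yes j<i) = ⊥-elim (<-asym i<j j<i)
  by-cases (yes _)   (no _)    = sym (trans (+-identityʳ _) (+-identityʳ _))
  by-cases (no _)    (yes _)   = sym (+-identityʳ _)
  by-cases (no i≮j)  (no j≮i) with <-cmp i j
  ... | tri< i<j _ _  = ⊥-elim (i≮j i<j)
  ... | tri> _ _ j<i  = ⊥-elim (j≮i j<i)
  ... | tri≈ _ refl _ = fᵢᵢ≡0 i

sum-ordered-pairs : ∀ {n} (f : Fin n → Fin n → ℕ) → (∀ i → f i i ≡ 0) →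
  sum (λ i → sum (λ j → f i j)) ≡ sum (λ i → sum (λ j → ⟦ i <ᵇ j ⟧ * (f i j + f j i)))
sum-ordered-pairs f fᵢᵢ≡0 = begin
  ∑∑ (λ i j → f i j)
    ≡⟨ sum-cong-≗ (λ i → sum-cong-≗ (order-split f fᵢᵢ≡0 i)) ⟩
  ∑∑ (λ i j → ⟦ i <ᵇ j ⟧ * f i j + ⟦ j <ᵇ i ⟧ * f i j)
    ≡⟨ ∑∑-distrib-+ (λ i j → ⟦ i <ᵇ j ⟧ * f i j) (λ i j → ⟦ j <ᵇ i ⟧ * f i j) ⟩
  ∑∑ (λ i j → ⟦ i <ᵇ j ⟧ * f i j) + ∑∑ (λ i j → ⟦ j <ᵇ i ⟧ * f i j)
    ≡⟨ cong (∑∑ (λ i j → ⟦ i <ᵇ j ⟧ * f i j) +_) (∑-comm (λ i j → ⟦ j <ᵇ i ⟧ * f i j)) ⟩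
  ∑∑ (λ i j → ⟦ i <ᵇ j ⟧ * f i j) + ∑∑ (λ i j → ⟦ i <ᵇ j ⟧ * f j i)
    ≡⟨ ∑∑-distrib-+ (λ i j → ⟦ i <ᵇ j ⟧ * f i j) (λ i j → ⟦ i <ᵇ j ⟧ * f j i) ⟨
  ∑∑ (λ i j → ⟦ i <ᵇ j ⟧ * f i j + ⟦ i <ᵇ j ⟧ * f j i)
    ≡⟨ sum-cong-≗ (λ i → sum-cong-≗ (λ j → *-distribˡ-+ ⟦ i <ᵇ j ⟧ (f i j) (f j i))) ⟨
  ∑∑ (λ i j → ⟦ i <ᵇ j ⟧ * (f i j + f j i))
    ∎
  where
  open ≡-Reasoning
  ∑∑ : (Fin _ → Fin _ → ℕ) → ℕ
  ∑∑ g = sum (λ i → sum (g i))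
  ∑∑-distrib-+ : ∀ g h → ∑∑ (λ i j → g i j + h i j) ≡ ∑∑ g + ∑∑ h
  ∑∑-distrib-+ g h =
    trans (sum-cong-≗ (λ i → ∑-distrib-+ (g i) (h i))) (∑-distrib-+ (λ i → sum (g i)) (λ i → sum (h i)))

edgeCount-as-sum : ∀ {n} {K : Graph n} (F : EdgeSet K) →
             edgeCount F ≡ sum (λ u → sum (λ v → ⟦ u <ᵇ v ⟧ * ⟦ mem F u v ⟧))
edgeCount-as-sum {n} F = trans (sumFin≡sum {n} _) (sum-cong-≗ λ u →
  trans (countFin≡count {n} _) (sum-cong-≗ λ v → ⟦∧⟧ (u <ᵇ v) (mem F u v)))

module _ {n} (G : Graph n) where

  adj-swap : ∀ {u v b} → adj G u v ≡ b → adj G v u ≡ b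
  adj-swap {u} {v} uv≡b = trans (adj-sym G v u) uv≡b

  adj⇒≢ : ∀ {u v} → adj G u v ≡ true → u ≢ v
  adj⇒≢ {u} uu≡true refl with trans (sym (irrefl G u)) uu≡true
  ... | ()

  adj⇒sqAdj : ∀ {u v} → adj G u v ≡ true → sqAdj G u v ≡ true
  adj⇒sqAdj {u} {v} uv with u ≟ v
  ... | yes u≡v = ⊥-elim (adj⇒≢ uv u≡v)
  ... | no _ rewrite uv = refl

  path₂⇒sqAdj : ∀ {u w v} → u ≢ v → adj G u w ≡ true → adj G w v ≡ true → sqAdj G u v ≡ true
  path₂⇒sqAdj {u} {w} {v} u≢v uw wv with u ≟ v
  ... | yes u≡v = ⊥-elim (u≢v u≡v)
  ... | no _ rewrite anyFin-witness (λ z → adj G u z ∧ adj G z v) w (cong₂ _∧_ uw wv) = ∨-zeroʳ (adj G u v)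

  outDegree : (Fin n → Bool) → Fin n → ℕ
  outDegree P z = count (λ v → adj G z v ∧ not (P v))

  cutSize : (Fin n → Bool) → ℕ
  cutSize P = sum (λ z → ⟦ P z ⟧ * outDegree P z)

  Separates : EdgeSet G → (Fin n → Bool) → Set
  Separates F P = ∀ z v → P z ≡ true → P v ≡ false → adj G z v ≡ true → mem F z v ≡ true

  cutSize≤edgeCount : ∀ F P → Separates F P → cutSize P ≤ edgeCount F
  cutSize≤edgeCount F P F-sep = begin
    cutSize P
      ≤⟨ sum-mono-≤ out-edges-in-F ⟩
    sum (λ z → sum (λ v → ⟦ F-out z v ⟧))
      ≡⟨ sum-ordered-pairs (λ z v → ⟦ F-out z v ⟧) F-out-irrefl ⟩
    sum (λ z → sum (λ v → ⟦ z <ᵇ v ⟧ * (⟦ F-out z v ⟧ + ⟦ F-out v z ⟧)))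
      ≤⟨ sum-mono-≤ (λ z → sum-mono-≤ (λ v → *-monoʳ-≤ ⟦ z <ᵇ v ⟧
           (crosses-one-way (P z) (P v) (memSym F v z)))) ⟩
    sum (λ z → sum (λ v → ⟦ z <ᵇ v ⟧ * ⟦ mem F z v ⟧))
      ≡⟨ edgeCount-as-sum F ⟨
    edgeCount F
      ∎
    where
    open ≤-Reasoning
    F-out : Fin n → Fin n → Bool
    F-out z v = P z ∧ not (P v) ∧ mem F z v

    out-edges-in-F : ∀ z → ⟦ P z ⟧ * outDegree P z ≤ count (F-out z)
    out-edges-in-F z with P z in Pz
    ... | false = z≤n
    ... | true  = ≤-trans (≤-reflexive (*-identityˡ _)) (count-mono crossing)
      where
      crossing : ∀ v → adj G z v ∧ not (P v) ≡ true → not (P v) ∧ mem F z v ≡ true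
      crossing v zv∧v∉P = cong₂ _∧_ v∉P (F-sep z v Pz (not-true v∉P) (∧-conicalˡ _ _ zv∧v∉P))
        where v∉P = ∧-conicalʳ _ _ zv∧v∉P

    F-out-irrefl : ∀ z → ⟦ F-out z z ⟧ ≡ 0
    F-out-irrefl z with P z
    ... | true  = refl
    ... | false = refl

    crosses-one-way : ∀ a b {m m′} → m′ ≡ m → ⟦ a ∧ not b ∧ m ⟧ + ⟦ b ∧ not a ∧ m′ ⟧ ≤ ⟦ m ⟧
    crosses-one-way true  true  _    = z≤n
    crosses-one-way true  false refl = ≤-reflexive (+-identityʳ _)
    crosses-one-way false true  refl = ≤-refl
    crosses-one-way false false _    = z≤n

module _ {n} (K : Graph n) where

  Closed : (Fin n → Bool) → Set
  Closed P = ∀ z w → P z ≡ true → adj K z w ≡ true → P w ≡ true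

  snoc : ∀ {u w v} → Reachable K u w → Adj K w v → Reachable K u v
  snoc here       wv = step wv here
  snoc (step x r) wv = step x (snoc r wv)

  module _ (u : Fin n) where

    ball : ℕ → Fin n → Bool
    ball zero    v = does (v ≟ u)
    ball (suc k) v = ball k v ∨ anyFin (λ z → ball k z ∧ adj K z v)

    ball⇒Reachable : ∀ k v → ball k v ≡ true → Reachable K u v
    ball⇒Reachable zero v v∈B with v ≟ u
    ... | yes refl = here
    ball⇒Reachable (suc k) v v∈B with ball k v in v∈Bₖ
    ... | true  = ball⇒Reachable k v v∈Bₖ
    ... | false with anyFin-elim _ v∈B
    ...   | z , zv with ∧-conicalˡ _ _ zv | ∧-conicalʳ _ _ zv
    ...     | z∈Bₖ | z~v = snoc (ball⇒Reachable k z z∈Bₖ) (Equivalence.from T-≡ z~v)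

    center∈ball : ∀ k → ball k u ≡ true
    center∈ball zero    = dec-true (u ≟ u) refl
    center∈ball (suc k) rewrite center∈ball k = refl

    ball-mono : ∀ k v → ball k v ≡ true → ball (suc k) v ≡ true
    ball-mono k v v∈B rewrite v∈B = refl

    Stable : ℕ → Set
    Stable k = ∀ v → ball (suc k) v ≡ true → ball k v ≡ true

    stable-or-growing : ∀ k → ∃ Stable ⊎ k + 1 ≤ count (ball k)
    stable-or-growing zero = inj₂ (≤-reflexive (sym (count-≟ u)))
    stable-or-growing (suc k) with stable-or-growing k
    ... | inj₁ stable = inj₁ stable
    ... | inj₂ grown with any? (λ v → (ball (suc k) v ≟ᴮ true) ×-dec (ball k v ≟ᴮ false))
    ...   | yes (v , v∈Bₖ₊₁ , v∉Bₖ) = inj₂ (begin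
      suc k + 1              ≡⟨ +-comm 1 (k + 1) ⟩
      k + 1 + 1              ≤⟨ +-monoˡ-≤ 1 grown ⟩
      count (ball k) + 1     ≤⟨ count-mono-< v (ball-mono k) v∉Bₖ v∈Bₖ₊₁ ⟩
      count (ball (suc k))   ∎)
      where open ≤-Reasoning
    ...   | no no-new = inj₁ (k , stable)
      where
      stable : Stable k
      stable v v∈Bₖ₊₁ with ball k v ≟ᴮ true
      ... | yes v∈Bₖ = v∈Bₖ
      ... | no v∉Bₖ  = ⊥-elim (no-new (v , v∈Bₖ₊₁ , ¬-not v∉Bₖ))

    -- While unstable the ball gains a vertex at each step, which cannot go on for n steps.
    stable-radius : ∃ Stable
    stable-radius with stable-or-growing n
    ... | inj₁ stable = stable
    ... | inj₂ grown  = ⊥-elim (1+n≰n (≤-trans (≤-reflexive (+-comm 1 n)) (≤-trans grown (count-≤ (ball n)))))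

    component : Fin n → Bool
    component = ball (proj₁ stable-radius)

    center∈component : component u ≡ true
    center∈component = center∈ball (proj₁ stable-radius)

    component⇒Reachable : ∀ v → component v ≡ true → Reachable K u v
    component⇒Reachable = ball⇒Reachable (proj₁ stable-radius)

    component-closed : Closed component
    component-closed z v z∈C zv = proj₂ stable-radius v
      (trans (cong (component v ∨_) (anyFin-witness _ z (cong₂ _∧_ z∈C zv))) (∨-zeroʳ (component v)))

  ¬connected⇒closed-split : ¬ Connected K →
    ∃ λ (P : Fin n → Bool) → ∃₂ λ u v → P u ≡ true × P v ≡ false × Closed P
  ¬connected⇒closed-split ¬conn with all? (λ u → all? (λ v → component u v ≟ᴮ true))
  ... | yes all-in = ⊥-elim (¬conn (λ u v → component⇒Reachable u v (all-in u v)))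
  ... | no ¬all-in with ¬∀⟶∃¬ n _ (λ u → all? (λ v → component u v ≟ᴮ true)) ¬all-in
  ...   | u , ¬all-in-u with ¬∀⟶∃¬ n _ (λ v → component u v ≟ᴮ true) ¬all-in-u
  ...     | v , v∉C = component u , u , v , center∈component u , ¬-not v∉C , component-closed u

n≤m*[n+1∸m]⊔1 : ∀ m n → 1 ≤ m → n ≤ m * ((n + 1 ∸ m) ⊔ 1)
n≤m*[n+1∸m]⊔1 m n 1≤m with ≤-total n m
... | inj₁ n≤m = ≤-trans n≤m (≤-trans (≤-reflexive (sym (*-identityʳ m))) (*-monoʳ-≤ m (m≤n⊔m _ 1)))
... | inj₂ m≤n = begin
  n                     ≡⟨ m+[n∸m]≡n m≤n ⟨
  m + (n ∸ m)           ≤⟨ +-monoʳ-≤ m (m≤n*m (n ∸ m) m ⦃ >-nonZero 1≤m ⦄) ⟩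
  m + m * (n ∸ m)       ≡⟨ *-suc m (n ∸ m) ⟨
  m * suc (n ∸ m)       ≡⟨ cong (m *_) (+-comm 1 (n ∸ m)) ⟩
  m * (n ∸ m + 1)       ≡⟨ cong (m *_) (+-∸-comm 1 m≤n) ⟨
  m * (n + 1 ∸ m)       ≤⟨ *-monoʳ-≤ m (m≤m⊔n _ 1) ⟩
  m * ((n + 1 ∸ m) ⊔ 1) ∎
  where open ≤-Reasoning

module _ {n} (K : Graph n) (P : Fin n → Bool) where

  degree≤outDegree+size : ∀ z → P z ≡ true → count (adj K z) + 1 ≤ outDegree K P z + count P
  degree≤outDegree+size z z∈P = begin
    count (adj K z) + 1           ≡⟨ cong (_+ 1) (count-split (adj K z) P) ⟩
    inside + out + 1              ≡⟨ xy∙z≈xz∙y inside out 1 ⟩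
    inside + 1 + out              ≤⟨ +-monoˡ-≤ out neighbours-and-z ⟩
    count P + out                 ≡⟨ +-comm (count P) out ⟩
    out + count P                 ∎
    where
    open ≤-Reasoning
    inside = count (λ v → adj K z v ∧ P v)
    out = outDegree K P z
    neighbours-and-z : inside + 1 ≤ count P
    neighbours-and-z = count-mono-< z (λ v → ∧-conicalʳ _ _) (cong (_∧ P z) (irrefl K z)) z∈P

  module _ (d : ℕ) (degree≥d : ∀ z → d ≤ count (adj K z)) where

    -- Otherwise every vertex of P has at least max(d + 1 − |P|, 1) neighbours outside P,
    -- and |P| · max(d + 1 − |P|, 1) ≥ d.
    interior-vertex : ∀ p → P p ≡ true → cutSize K P < d → ∃ λ u → P u ≡ true × outDegree K P u ≡ 0
    interior-vertex p p∈P cut<d with any? (λ u → (P u ≟ᴮ true) ×-dec (outDegree K P u ≟ℕ 0))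
    ... | yes interior    = interior
    ... | no no-interior = ⊥-elim (<⇒≱ cut<d d≤cut)
      where
      s = count P
      k = (d + 1 ∸ s) ⊔ 1
      outDegree≥k : ∀ z → ⟦ P z ⟧ * k ≤ ⟦ P z ⟧ * outDegree K P z
      outDegree≥k z with P z in z∈P
      ... | false = z≤n
      ... | true  = *-monoʳ-≤ 1 (⊔-lub outDegree≥d+1∸s outDegree≥1)
        where
        outDegree≥d+1∸s : d + 1 ∸ s ≤ outDegree K P z
        outDegree≥d+1∸s =
          ≤-trans (∸-monoˡ-≤ s (≤-trans (+-monoˡ-≤ 1 (degree≥d z)) (degree≤outDegree+size z z∈P)))
                  (≤-reflexive (m+n∸n≡m (outDegree K P z) s))
        outDegree≥1 : 1 ≤ outDegree K P z
        outDegree≥1 with outDegree K P z in out≡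
        ... | zero  = ⊥-elim (no-interior (z , z∈P , out≡))
        ... | suc _ = s≤s z≤n
      d≤cut : d ≤ cutSize K P
      d≤cut = ≤-trans (n≤m*[n+1∸m]⊔1 s d (count-pos P p p∈P))
                (≤-trans (≤-reflexive (sym (sum-weighted P k))) (sum-mono-≤ outDegree≥k))

    interior⇒size : ∀ u → P u ≡ true → outDegree K P u ≡ 0 → d + 1 ≤ count P
    interior⇒size u u∈P out≡0 = ≤-trans (+-monoˡ-≤ 1 (degree≥d u))
      (≤-trans (degree≤outDegree+size u u∈P) (≤-reflexive (cong (_+ count P) out≡0)))

  interior⇒neighbours∈ : ∀ u → outDegree K P u ≡ 0 → ∀ v → adj K u v ≡ true → P v ≡ true
  interior⇒neighbours∈ u out≡0 v uv with P v in v∈P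
  ... | true  = refl
  ... | false = ⊥-elim (1+n≰n (≤-trans (count-pos _ v (cong₂ _∧_ uv (cong not v∈P))) (≤-reflexive out≡0)))

module _ {n} (G : Graph n) where

  Shortcutless : ∀ {u w} → Reachable G u w → Set
  Shortcutless here          = ⊤
  Shortcutless (step _ here) = ⊤
  Shortcutless (step {u} _ (step {w = c} bc r)) = u ≢ c × adj G u c ≡ false × Shortcutless (step bc r)

  shortcutless-tail : ∀ {u v w} (uv : Adj G u v) (W : Reachable G v w) → Shortcutless (step uv W) → Shortcutless W
  shortcutless-tail uv here       _                 = tt
  shortcutless-tail uv (step _ _) (_ , _ , tail-sl) = tail-sl

  shortcutless-cons : ∀ {a b w} → Adj G a b → (W : Reachable G b w) → Shortcutless W →
                      Σ (Reachable G a w) Shortcutless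
  shortcutless-cons ab here _ = step ab here , tt
  shortcutless-cons {a} ab (step {w = c} bc W) sl with a ≟ c
  ... | yes refl = W , shortcutless-tail bc W sl
  ... | no a≢c with adj G a c in ac
  ...   | true  = shortcutless-cons (Equivalence.from T-≡ ac) W (shortcutless-tail bc W sl)
  ...   | false = step ab (step bc W) , a≢c , ac , sl

  shortcutless-walk : ∀ {a w} → Reachable G a w → Σ (Reachable G a w) Shortcutless
  shortcutless-walk here        = here , tt
  shortcutless-walk (step ab W) = shortcutless-cons ab (proj₁ (shortcutless-walk W)) (proj₂ (shortcutless-walk W))

  record Crossing (S : Fin n → Bool) : Set where
    field
      x y x′ y′ : Fin n
      x∈S  : S x ≡ true
      y∉S  : S y ≡ false
      x~y  : adj G x y ≡ true
      x~x′ : adj G x x′ ≡ true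
      x′≢y : x′ ≢ y
      y~y′ : adj G y y′ ≡ true
      y′≢x : y′ ≢ x
      y′≁x : adj G y′ x ≡ false
      sides : (S x′ ≡ true × S y′ ≡ false) ⊎ (S x′ ≡ false × S y′ ≡ true)

  module _ (S : Fin n → Bool) where

    private
      T⇒≡ : ∀ {u v} → Adj G u v → adj G u v ≡ true
      T⇒≡ = Equivalence.to T-≡

    -- At the first step b → c out of S: if the next vertex d is outside S, then (b, c, a, d)
    -- is a crossing; if d is back in S, then either the following vertex e is outside S and
    -- (d, c, e, b) is a crossing, or the scan restarts at d → e.
    crossing-along : ∀ {a b w} (ab : Adj G a b) (W : Reachable G b w) → Shortcutless (step ab W) →
      S a ≡ true → S b ≡ true → S w ≡ false → (∀ v → adj G w v ≡ true → S v ≡ false) → Crossing S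
    crossing-along ab here _ _ b∈S w∉S _ = ⊥-elim (not-¬ b∈S w∉S)
    crossing-along ab (step {w = c} bc W) sl a∈S b∈S w∉S w-nbrs∉S with S c in c∈S
    ... | true = crossing-along bc W (shortcutless-tail ab (step bc W) sl) b∈S c∈S w∉S w-nbrs∉S
    crossing-along ab (step bc here) _ _ b∈S _ w-nbrs∉S | false =
      ⊥-elim (not-¬ b∈S (w-nbrs∉S _ (adj-swap G (T⇒≡ bc))))
    crossing-along {a} {b} ab (step {w = c} bc (step {w = d} cd W)) (a≢c , _ , b≢d , b≁d , _)
      a∈S b∈S w∉S w-nbrs∉S | false with S d in d∈S
    ... | false = record
      { x = b ; y = c ; x′ = a ; y′ = d ; x∈S = b∈S ; y∉S = c∈S
      ; x~y = T⇒≡ bc ; x~x′ = adj-swap G (T⇒≡ ab) ; x′≢y = a≢c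
      ; y~y′ = T⇒≡ cd ; y′≢x = ≢-sym b≢d ; y′≁x = adj-swap G b≁d
      ; sides = inj₁ (a∈S , d∈S) }
    crossing-along ab (step bc (step cd here)) _ _ _ w∉S _ | false | true = ⊥-elim (not-¬ d∈S w∉S)
    crossing-along {a} {b} ab (step {w = c} bc (step {w = d} cd (step {w = e} de W)))
      (_ , _ , b≢d , b≁d , c≢e , _ , sl) a∈S b∈S w∉S w-nbrs∉S | false | true with S e in e∈S
    ... | false = record
      { x = d ; y = c ; x′ = e ; y′ = b ; x∈S = d∈S ; y∉S = c∈S
      ; x~y = adj-swap G (T⇒≡ cd) ; x~x′ = T⇒≡ de ; x′≢y = ≢-sym c≢e
      ; y~y′ = adj-swap G (T⇒≡ bc) ; y′≢x = b≢d ; y′≁x = b≁d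
      ; sides = inj₂ (e∈S , b∈S) }
    ... | true = crossing-along de W sl d∈S e∈S w∉S w-nbrs∉S

    crossing : ∀ {u w} → Reachable G u w → S u ≡ true → (∀ v → adj G u v ≡ true → S v ≡ true) →
               S w ≡ false → (∀ v → adj G w v ≡ true → S v ≡ false) → Crossing S
    crossing W u∈S u-nbrs∈S w∉S w-nbrs∉S with shortcutless-walk W
    ... | here , _ = ⊥-elim (not-¬ u∈S w∉S)
    ... | step {w = b} ub W′ , sl = crossing-along ub W′ sl u∈S (u-nbrs∈S b (T⇒≡ ub)) w∉S w-nbrs∉S

-- ⟦ true ⟧ * k normalises to k + 0, which the weighted cut bounds below must absorb.
≤-+0 : ∀ {m n} → m ≤ n → m + 0 ≤ n
≤-+0 {m} = subst (_≤ _) (sym (+-identityʳ m))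

2*-≤-+ : ∀ {m n o} → m ≤ n → m ≤ o → 2 * m ≤ n + o
2*-≤-+ {m} {n} {o} m≤n m≤o = subst (_≤ n + o) (cong (m +_) (sym (+-identityʳ m))) (+-mono-≤ m≤n m≤o)

2[a+b]≤a*b+[b+1]+1 : ∀ a b → 1 ≤ a → 2 ≤ b → 2 * (a + b) ≤ a * b + (b + 1) + 1
2[a+b]≤a*b+[b+1]+1 (suc a) (suc (suc b)) _ _ =
  ≤-trans (m≤m+n _ (a * b)) (≤-reflexive (identity a b))
  where
  identity : ∀ a b → 2 * (suc a + suc (suc b)) + a * b ≡ suc a * suc (suc b) + (suc (suc b) + 1) + 1
  identity = solve-∀
2[a+b]≤a*b+[b+1]+1 (suc a) (suc zero) _ (s≤s ())

[c+p]+[p+q]≤p*[q+1]+c+1 : ∀ c p q → 1 ≤ p → 1 ≤ q → (c + p) + (p + q) ≤ p * (q + 1) + c + 1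
[c+p]+[p+q]≤p*[q+1]+c+1 c (suc p) (suc q) _ _ =
  ≤-trans (m≤m+n _ (p * q)) (≤-reflexive (identity c p q))
  where
  identity : ∀ c p q → (c + suc p) + (suc p + suc q) + p * q ≡ suc p * (suc q + 1) + c + 1
  identity = solve-∀

r+1+q≤r*[q+1]+1 : ∀ r q → 1 ≤ r → r + 1 + q ≤ r * (q + 1) + 1
r+1+q≤r*[q+1]+1 (suc r) q _ = ≤-trans (m≤m+n _ (r * q)) (≤-reflexive (identity r q))
  where
  identity : ∀ r q → suc r + 1 + q + r * q ≡ suc r * (q + 1) + 1
  identity = solve-∀

sum-weighted₂ : ∀ {n} (A B : Fin n → Bool) k l →
                sum (λ z → ⟦ A z ⟧ * k + ⟦ B z ⟧ * l) ≡ count A * k + count B * l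
sum-weighted₂ A B k l =
  trans (∑-distrib-+ (λ z → ⟦ A z ⟧ * k) (λ z → ⟦ B z ⟧ * l)) (cong₂ _+_ (sum-weighted A k) (sum-weighted B l))

module _ {n} (G : Graph n) (S : Fin n → Bool) where

  private
    out² : Fin n → ℕ
    out² = outDegree (square G) S

    ∉⇒≢ : ∀ {z v} → S z ≡ true → S v ≡ false → z ≢ v
    ∉⇒≢ z∈S v∉S refl = not-¬ z∈S v∉S

  outside-neighbour⇒outside-square-neighbour : ∀ {w z} → S z ≡ true → (w ≡ z ⊎ adj G w z ≡ true) →
    ∀ v → adj G w v ∧ not (S v) ≡ true → sqAdj G z v ∧ not (S v) ≡ true
  outside-neighbour⇒outside-square-neighbour z∈S w≈z v wv∧v∉S = cong₂ _∧_ (square-adj w≈z) v∉S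
    where
    v∉S = ∧-conicalʳ _ _ wv∧v∉S
    wv = ∧-conicalˡ _ _ wv∧v∉S
    square-adj : _ → sqAdj G _ v ≡ true
    square-adj (inj₁ refl) = adj⇒sqAdj G wv
    square-adj (inj₂ wz)   = path₂⇒sqAdj G (∉⇒≢ z∈S (not-true v∉S)) (adj-swap G wz) wv

  cutSize²≥ : (g : Fin n → ℕ) → (∀ z → S z ≡ true → g z ≤ out² z) →
              (∀ z → S z ≡ false → g z ≡ 0) → sum g ≤ cutSize (square G) S
  cutSize²≥ g g≤out² g-outside = sum-mono-≤ pointwise
    where
    pointwise : ∀ z → g z ≤ ⟦ S z ⟧ * out² z
    pointwise z with S z in z∈S
    ... | true  = ≤-trans (g≤out² z z∈S) (≤-reflexive (sym (+-identityʳ _)))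
    ... | false = ≤-reflexive (g-outside z z∈S)

  module _ (δ : ℕ) (degree≥δ : ∀ z → δ ≤ count (adj G z)) (C : Crossing G S) where
    open Crossing C

    private
      a = count (λ v → adj G x v ∧ S v)
      b = outDegree G S x
      p = count (λ v → adj G y v ∧ S v)
      q = outDegree G S y

      δ≤a+b : δ ≤ a + b
      δ≤a+b = ≤-trans (degree≥δ x) (≤-reflexive (count-split (adj G x) S))

      δ≤p+q : δ ≤ p + q
      δ≤p+q = ≤-trans (degree≥δ y) (≤-reflexive (count-split (adj G y) S))

      b≤out²-near-x : ∀ z → S z ≡ true → (x ≡ z ⊎ adj G x z ≡ true) → b ≤ out² z
      b≤out²-near-x z z∈S x≈z = count-mono (outside-neighbour⇒outside-square-neighbour z∈S x≈z)

      q<out²-near-y : ∀ z → S z ≡ true → adj G y z ≡ true → q + 1 ≤ out² z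
      q<out²-near-y z z∈S yz = count-mono-< y (outside-neighbour⇒outside-square-neighbour z∈S (inj₂ yz))
        (cong (_∧ not (S y)) (irrefl G y)) (cong₂ _∧_ (adj⇒sqAdj G (adj-swap G yz)) (cong not y∉S))

      b<out²-x : S y′ ≡ false → b + 1 ≤ out² x
      b<out²-x y′∉S = count-mono-< y′ (outside-neighbour⇒outside-square-neighbour x∈S (inj₁ refl))
        (cong (_∧ not (S y′)) (adj-swap G y′≁x))
        (cong₂ _∧_ (path₂⇒sqAdj G (≢-sym y′≢x) x~y y~y′) (cong not y′∉S))

    -- Every vertex of S in the closed neighbourhood of x sees the b outside neighbours of x
    -- in G²; the extra 1 is y′, as a further outside G²-neighbour of x when y′ ∉ S, or as a
    -- vertex of S seeing y when y′ ∈ S.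
    cutSize²≥a*b+b+1 : a * b + (b + 1) ≤ cutSize (square G) S
    cutSize²≥a*b+b+1 with S y′ in y′∈S
    ... | false = ≤-trans (≤-reflexive total) (cutSize²≥ g g≤out² g-outside)
      where
      g : Fin n → ℕ
      g z = ⟦ adj G x z ∧ S z ⟧ * b + ⟦ does (z ≟ x) ⟧ * (b + 1)
      total : a * b + (b + 1) ≡ sum g
      total = sym (trans (sum-weighted₂ {n} _ _ b (b + 1))
                         (trans (cong (λ k → a * b + k * (b + 1)) (count-≟ x)) (cong (a * b +_) (*-identityˡ (b + 1)))))
      g≤out² : ∀ z → S z ≡ true → g z ≤ out² z
      g≤out² z z∈S with z ≟ x
      ... | yes refl rewrite irrefl G x = ≤-+0 (b<out²-x y′∈S)
      ... | no _ with adj G x z in xz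
      ...   | false = z≤n
      ...   | true rewrite z∈S = ≤-+0 (≤-+0 (b≤out²-near-x z z∈S (inj₂ xz)))
      g-outside : ∀ z → S z ≡ false → g z ≡ 0
      g-outside z z∉S rewrite z∉S | ∧-zeroʳ (adj G x z) | dec-false (z ≟ x) (∉⇒≢ x∈S z∉S ∘ sym) = refl
    ... | true = ≤-trans (≤-reflexive total) (cutSize²≥ g g≤out² g-outside)
      where
      g : Fin n → ℕ
      g z = ⟦ adj G x z ∧ S z ⟧ * b + (⟦ does (z ≟ x) ⟧ * b + ⟦ does (z ≟ y′) ⟧ * 1)
      total : a * b + (b + 1) ≡ sum g
      total = sym (begin
        sum g
          ≡⟨ ∑-distrib-+ {n} (λ z → ⟦ adj G x z ∧ S z ⟧ * b) _ ⟩
        sum (λ z → ⟦ adj G x z ∧ S z ⟧ * b) + sum (λ z → ⟦ does (z ≟ x) ⟧ * b + ⟦ does (z ≟ y′) ⟧ * 1)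
          ≡⟨ cong₂ _+_ (sum-weighted {n} _ b) (sum-weighted₂ {n} _ _ b 1) ⟩
        a * b + (count (λ z → does (z ≟ x)) * b + count (λ z → does (z ≟ y′)) * 1)
          ≡⟨ cong₂ (λ k l → a * b + (k * b + l * 1)) (count-≟ x) (count-≟ y′) ⟩
        a * b + (1 * b + 1 * 1)
          ≡⟨ cong (λ k → a * b + (k + 1)) (*-identityˡ b) ⟩
        a * b + (b + 1)
          ∎)
        where open ≡-Reasoning
      g≤out² : ∀ z → S z ≡ true → g z ≤ out² z
      g≤out² z z∈S with z ≟ x | z ≟ y′
      ... | yes refl | yes x≡y′ = ⊥-elim (y′≢x (sym x≡y′))
      ... | yes refl | no _     rewrite irrefl G x = ≤-+0 (≤-+0 (b≤out²-near-x x z∈S (inj₁ refl)))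
      ... | no _     | yes refl rewrite adj-swap G y′≁x = ≤-trans (m≤n+m 1 q) (q<out²-near-y y′ z∈S y~y′)
      ... | no _     | no _ with adj G x z in xz
      ...   | false = z≤n
      ...   | true rewrite z∈S = ≤-+0 (≤-+0 (b≤out²-near-x z z∈S (inj₂ xz)))
      g-outside : ∀ z → S z ≡ false → g z ≡ 0
      g-outside z z∉S rewrite z∉S | ∧-zeroʳ (adj G x z)
        | dec-false (z ≟ x) (∉⇒≢ x∈S z∉S ∘ sym) | dec-false (z ≟ y′) (∉⇒≢ y′∈S z∉S ∘ sym) = refl

    -- Each vertex of N(y) ∩ S sees y and N(y) ∖ S in G², and each vertex of N(x) ∩ S
    -- outside N(y) still sees y through x.
    crossing-bound-b≤1 : S y′ ≡ false → b ≤ 1 → 2 * δ ≤ cutSize (square G) S + 1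
    crossing-bound-b≤1 y′∉S b≤1 = begin
      2 * δ                       ≤⟨ 2*-≤-+ (≤-trans δ≤a+b (+-monoʳ-≤ a b≤1)) δ≤p+q ⟩
      (a + 1) + (p + q)           ≤⟨ +-monoˡ-≤ (p + q) a+1≤c+p ⟩
      (c + p) + (p + q)           ≤⟨ [c+p]+[p+q]≤p*[q+1]+c+1 c p q 1≤p 1≤q ⟩
      p * (q + 1) + c + 1         ≡⟨ cong (_+ 1) total ⟩
      sum g + 1                   ≤⟨ +-monoˡ-≤ 1 (cutSize²≥ g g≤out² g-outside) ⟩
      cutSize (square G) S + 1    ∎
      where
      open ≤-Reasoning
      N[x]∩S N[y]∩S N[x]∩S∖N[y] : Fin n → Bool
      N[x]∩S z = adj G x z ∧ S z
      N[y]∩S z = adj G y z ∧ S z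
      N[x]∩S∖N[y] z = N[x]∩S z ∧ not (adj G y z)
      c = count N[x]∩S∖N[y]
      g : Fin n → ℕ
      g z = ⟦ N[y]∩S z ⟧ * (q + 1) + ⟦ N[x]∩S∖N[y] z ⟧ * 1
      total : p * (q + 1) + c ≡ sum g
      total = sym (trans (sum-weighted₂ {n} N[y]∩S N[x]∩S∖N[y] (q + 1) 1) (cong (p * (q + 1) +_) (*-identityʳ c)))
      1≤p : 1 ≤ p
      1≤p = count-pos N[y]∩S x (cong₂ _∧_ (adj-swap G x~y) x∈S)
      1≤q : 1 ≤ q
      1≤q = count-pos _ y′ (cong₂ _∧_ y~y′ (cong not y′∉S))
      a+1≤c+p : a + 1 ≤ c + p
      a+1≤c+p = begin
        a + 1               ≡⟨ cong (_+ 1) (count-split N[x]∩S (adj G y)) ⟩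
        common + c + 1      ≡⟨ xy∙z≈xz∙y common c 1 ⟩
        common + 1 + c      ≤⟨ +-monoˡ-≤ c common<p ⟩
        p + c               ≡⟨ +-comm p c ⟩
        c + p               ∎
        where
        common = count (λ z → N[x]∩S z ∧ adj G y z)
        common⊆N[y]∩S : ∀ z → N[x]∩S z ∧ adj G y z ≡ true → N[y]∩S z ≡ true
        common⊆N[y]∩S z h =
          cong₂ _∧_ (∧-conicalʳ (N[x]∩S z) _ h) (∧-conicalʳ (adj G x z) _ (∧-conicalˡ _ (adj G y z) h))
        common<p : common + 1 ≤ p
        common<p = count-mono-< x common⊆N[y]∩S
          (cong (λ t → (t ∧ S x) ∧ adj G y x) (irrefl G x)) (cong₂ _∧_ (adj-swap G x~y) x∈S)
      g≤out² : ∀ z → S z ≡ true → g z ≤ out² z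
      g≤out² z z∈S with adj G y z in yz | adj G x z in xz
      ... | true  | true  rewrite z∈S = ≤-+0 (≤-+0 (q<out²-near-y z z∈S yz))
      ... | true  | false rewrite z∈S = ≤-+0 (≤-+0 (q<out²-near-y z z∈S yz))
      ... | false | true  rewrite z∈S =
        count-pos _ y (cong₂ _∧_ (path₂⇒sqAdj G (∉⇒≢ z∈S y∉S) (adj-swap G xz) x~y) (cong not y∉S))
      ... | false | false = z≤n
      g-outside : ∀ z → S z ≡ false → g z ≡ 0
      g-outside z z∉S rewrite z∉S | ∧-zeroʳ (adj G y z) | ∧-zeroʳ (adj G x z) = refl

    -- x sees all of N(x) ∖ S, and each vertex of N(y) ∩ S other than x sees y and N(y) ∖ S.
    crossing-bound-a≡0 : S y′ ≡ true → a ≡ 0 → 2 * δ ≤ cutSize (square G) S + 1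
    crossing-bound-a≡0 y′∈S a≡0 = begin
      2 * δ                       ≤⟨ 2*-≤-+ δ≤b (≤-trans δ≤p+q (+-monoˡ-≤ q p≤r+1)) ⟩
      b + (r + 1 + q)             ≤⟨ +-monoʳ-≤ b (r+1+q≤r*[q+1]+1 r q 1≤r) ⟩
      b + (r * (q + 1) + 1)       ≡⟨ +-assoc b _ 1 ⟨
      b + r * (q + 1) + 1         ≡⟨ cong (_+ 1) total ⟩
      sum g + 1                   ≤⟨ +-monoˡ-≤ 1 (cutSize²≥ g g≤out² g-outside) ⟩
      cutSize (square G) S + 1    ∎
      where
      open ≤-Reasoning
      N[y]∩S∖x : Fin n → Bool
      N[y]∩S∖x z = (adj G y z ∧ S z) ∧ not (does (z ≟ x))
      r = count N[y]∩S∖x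
      g : Fin n → ℕ
      g z = ⟦ does (z ≟ x) ⟧ * b + ⟦ N[y]∩S∖x z ⟧ * (q + 1)
      total : b + r * (q + 1) ≡ sum g
      total = sym (trans (sum-weighted₂ {n} _ N[y]∩S∖x b (q + 1))
                         (trans (cong (λ k → k * b + r * (q + 1)) (count-≟ x)) (cong (_+ r * (q + 1)) (*-identityˡ b))))
      δ≤b : δ ≤ b
      δ≤b = subst (δ ≤_) (cong (_+ b) a≡0) δ≤a+b
      1≤r : 1 ≤ r
      1≤r = count-pos N[y]∩S∖x y′
              (cong₂ _∧_ (cong₂ _∧_ y~y′ y′∈S) (cong not (dec-false (y′ ≟ x) y′≢x)))
      p≤r+1 : p ≤ r + 1
      p≤r+1 = begin
        p                                                   ≡⟨ count-split (λ z → adj G y z ∧ S z) (λ z → does (z ≟ x)) ⟩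
        count (λ z → (adj G y z ∧ S z) ∧ does (z ≟ x)) + r  ≤⟨ +-monoˡ-≤ r at-most-x ⟩
        1 + r                                               ≡⟨ +-comm 1 r ⟩
        r + 1                                               ∎
        where
        at-most-x : count (λ z → (adj G y z ∧ S z) ∧ does (z ≟ x)) ≤ 1
        at-most-x = ≤-trans (count-mono (λ z → ∧-conicalʳ (adj G y z ∧ S z) _)) (≤-reflexive (count-≟ x))
      g≤out² : ∀ z → S z ≡ true → g z ≤ out² z
      g≤out² z z∈S with z ≟ x
      ... | yes refl rewrite ∧-zeroʳ (adj G y x ∧ S x) = ≤-+0 (≤-+0 (b≤out²-near-x x z∈S (inj₁ refl)))
      ... | no _ with adj G y z in yz
      ...   | false = z≤n
      ...   | true rewrite z∈S = ≤-+0 (q<out²-near-y z z∈S yz)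
      g-outside : ∀ z → S z ≡ false → g z ≡ 0
      g-outside z z∉S rewrite z∉S | ∧-zeroʳ (adj G y z) | dec-false (z ≟ x) (∉⇒≢ x∈S z∉S ∘ sym) = refl

    crossing-bound : 2 * δ ≤ cutSize (square G) S + 1
    crossing-bound with 1 ≤? a | 2 ≤? b | sides
    ... | yes 1≤a | yes 2≤b | _ = begin
      2 * δ                     ≤⟨ *-monoʳ-≤ 2 δ≤a+b ⟩
      2 * (a + b)               ≤⟨ 2[a+b]≤a*b+[b+1]+1 a b 1≤a 2≤b ⟩
      a * b + (b + 1) + 1       ≤⟨ +-monoˡ-≤ 1 cutSize²≥a*b+b+1 ⟩
      cutSize (square G) S + 1  ∎
      where open ≤-Reasoning
    ... | _       | no b≱2  | inj₁ (_ , y′∉S)    = crossing-bound-b≤1 y′∉S (≤-pred (≰⇒> b≱2))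
    ... | no a≱1  | _       | inj₂ (_ , y′∈S)    = crossing-bound-a≡0 y′∈S (n<1⇒n≡0 (≰⇒> a≱1))
    ... | yes _   | no b≱2  | inj₂ (x′∉S , _)    = ⊥-elim (b≱2 two-outside)
      where
      two-outside : 2 ≤ b
      two-outside = subst (λ k → k + 1 ≤ b) (count-≟ y)
        (count-mono-< x′ y-outside (dec-false (x′ ≟ y) x′≢y) (cong₂ _∧_ x~x′ (cong not x′∉S)))
        where
        y-outside : ∀ v → does (v ≟ y) ≡ true → adj G x v ∧ not (S v) ≡ true
        y-outside v v≟y with ≟⇒≡ {u = v} {y} v≟y
        ... | refl = cong₂ _∧_ x~y (cong not y∉S)
    ... | no a≱1  | yes _   | inj₁ (x′∈S , _)    = ⊥-elim (a≱1 (count-pos _ x′ (cong₂ _∧_ x~x′ x′∈S)))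

module _ {n} (K : Graph n) (c : Fin n) where

  private
    at-c : Fin n → Bool
    at-c u = does (u ≟ c)

  star : EdgeSet K
  star = record
    { mem    = λ u v → (at-c u ∨ at-c v) ∧ adj K u v
    ; memSym = λ u v → cong₂ _∧_ (∨-comm (at-c u) (at-c v)) (adj-sym K u v)
    ; sub    = λ u v uv∈star → Equivalence.from T-≡ (∧-conicalʳ _ _ (Equivalence.to T-≡ uv∈star)) }

  edgeCount-star : edgeCount star ≡ degree K c
  edgeCount-star = begin
    edgeCount star
      ≡⟨ edgeCount-as-sum star ⟩
    sum (λ u → sum (λ v → ⟦ u <ᵇ v ⟧ * ⟦ mem star u v ⟧))
      ≡⟨ sum-cong-≗ (λ u → sum-cong-≗ (λ v → cong (⟦ u <ᵇ v ⟧ *_) (star-split u v))) ⟩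
    sum (λ u → sum (λ v → ⟦ u <ᵇ v ⟧ * (f u v + f v u)))
      ≡⟨ sum-ordered-pairs f f-irrefl ⟨
    sum (λ u → sum (λ v → f u v))
      ≡⟨ sum-concentrated (λ u → sum (f u)) c
           (λ u u≢c → sum-zero (λ v → cong (λ t → ⟦ t ∧ adj K u v ⟧) (dec-false (u ≟ c) u≢c))) ⟩
    sum (λ v → ⟦ at-c c ∧ adj K c v ⟧)
      ≡⟨ sum-cong-≗ (λ v → cong (λ t → ⟦ t ∧ adj K c v ⟧) (dec-true (c ≟ c) refl)) ⟩
    count (adj K c)
      ≡⟨ countFin≡count (adj K c) ⟨
    degree K c
      ∎
    where
    open ≡-Reasoning
    f : Fin n → Fin n → ℕ
    f u v = ⟦ at-c u ∧ adj K u v ⟧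
    f-irrefl : ∀ u → f u u ≡ 0
    f-irrefl u rewrite irrefl K u = cong ⟦_⟧ (∧-zeroʳ (at-c u))
    star-split : ∀ u v → ⟦ mem star u v ⟧ ≡ f u v + f v u
    star-split u v rewrite adj-sym K v u with adj K u v in uv
    ... | false rewrite ∧-zeroʳ (at-c u ∨ at-c v) | ∧-zeroʳ (at-c u) | ∧-zeroʳ (at-c v) = refl
    ... | true rewrite ∧-identityʳ (at-c u ∨ at-c v) | ∧-identityʳ (at-c u) | ∧-identityʳ (at-c v)
      with u ≟ c | v ≟ c
    ...   | yes refl | yes refl = ⊥-elim (adj⇒≢ K uv refl)
    ...   | yes _    | no _     = refl
    ...   | no _     | yes _    = refl
    ...   | no _     | no _     = refl

  star-disconnects : ∀ v → v ≢ c → ¬ Connected (K ─ star)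
  star-disconnects v v≢c conn = v≢c (stuck (conn c v) refl)
    where
    stuck : ∀ {a b} → Reachable (K ─ star) a b → a ≡ c → b ≡ c
    stuck here a≡c = a≡c
    stuck (step {w = w} cw _) refl rewrite dec-true (c ≟ c) refl with adj K c w
    stuck (step () _) refl | true
    stuck (step () _) refl | false

other-vertex : ∀ {m} → 1 ≤ m → (c : Fin (suc m)) → ∃ λ v → v ≢ c
other-vertex {suc m} _ zero    = suc zero , λ ()
other-vertex {suc m} _ (suc _) = zero , λ ()

n≤4*[[n+2]/4]+1 : ∀ n → n ≤ 4 * ((n + 2) / 4) + 1
n≤4*[[n+2]/4]+1 n = +-cancelʳ-≤ 2 n _ (begin
  n + 2                           ≡⟨ m≡m%n+[m/n]*n (n + 2) 4 ⟩
  (n + 2) % 4 + (n + 2) / 4 * 4   ≤⟨ +-monoˡ-≤ _ (≤-pred (m%n<n (n + 2) 4)) ⟩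
  3 + (n + 2) / 4 * 4             ≡⟨ identity ((n + 2) / 4) ⟩
  4 * ((n + 2) / 4) + 1 + 2       ∎)
  where
  open ≤-Reasoning
  identity : ∀ k → 3 + k * 4 ≡ 4 * k + 1 + 2
  identity = solve-∀

minDegree≤count : ∀ {m} (K : Graph (suc m)) z → minDegree K ≤ count (adj K z)
minDegree≤count K z = ≤-trans (minFin-≤ (degree K) z) (≤-reflexive (countFin≡count (adj K z)))

module _ {n} {K : Graph n} (F : EdgeSet K) where

  closed⇒separates : ∀ P → Closed (K ─ F) P → Separates K F P
  closed⇒separates P closed z v z∈P v∉P zv with mem F z v in zv∈F
  ... | true  = refl
  ... | false = ⊥-elim (not-¬ (closed z v z∈P (cong₂ _∧_ zv (cong not zv∈F))) v∉P)

  separates-complement : ∀ P → Separates K F P → Separates K F (not ∘ P)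
  separates-complement P sep z v z∉P v∈P zv =
    trans (memSym F z v) (sep v z (not-false v∈P) (not-true z∉P) (adj-swap K zv))

module _ {m} (G : Graph (suc m)) (F : EdgeSet (square G)) (F<δ² : edgeCount F < minDegree (square G)) where

  private
    d = minDegree (square G)

  record Interior (P : Fin (suc m) → Bool) : Set where
    field
      center      : Fin (suc m)
      center∈     : P center ≡ true
      neighbours∈ : ∀ v → adj G center v ≡ true → P v ≡ true
      size>d      : d + 1 ≤ count P

  interior-of-side : ∀ P → Separates (square G) F P → ∀ p → P p ≡ true → Interior P
  interior-of-side P sep p p∈P with interior-vertex (square G) P d (minDegree≤count (square G)) p p∈P
                                      (≤-<-trans (cutSize≤edgeCount (square G) F P sep) F<δ²)
  ... | u , u∈P , out≡0 = record
    { center      = u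
    ; center∈     = u∈P
    ; neighbours∈ = λ v uv → interior⇒neighbours∈ (square G) P u out≡0 v (adj⇒sqAdj G uv)
    ; size>d      = interior⇒size (square G) P d (minDegree≤count (square G)) u u∈P out≡0 }

  small-cut-does-not-disconnect : Connected G → (suc m + 2) / 4 ≤ minDegree G → ¬ ¬ Connected (square G ─ F)
  small-cut-does-not-disconnect conn δ-bound ¬conn =
    side-too-small (¬connected⇒closed-split (square G ─ F) ¬conn)
    where
    δ = minDegree G
    side-too-small : (∃ λ P → ∃₂ λ p q → P p ≡ true × P q ≡ false × Closed (square G ─ F) P) → ⊥
    side-too-small (P , p , q , p∈P , q∉P , closed) = 1+n≰n (begin
      suc (4 * δ + 1)             ≡⟨ identity δ ⟩
      (2 * δ + 1) + (2 * δ + 1)   ≤⟨ +-mono-≤ (+-monoˡ-≤ 1 2δ≤d) (+-monoˡ-≤ 1 2δ≤d) ⟩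
      (d + 1) + (d + 1)           ≤⟨ +-mono-≤ (Interior.size>d inP) (Interior.size>d inQ) ⟩
      count P + count (not ∘ P)   ≡⟨ trans (sym (count-all {suc m})) (count-split (λ _ → true) P) ⟨
      suc m                       ≤⟨ ≤-trans (n≤4*[[n+2]/4]+1 (suc m)) (+-monoˡ-≤ 1 (*-monoʳ-≤ 4 δ-bound)) ⟩
      4 * δ + 1                   ∎)
      where
      open ≤-Reasoning
      identity : ∀ δ → suc (4 * δ + 1) ≡ (2 * δ + 1) + (2 * δ + 1)
      identity = solve-∀
      P-sep : Separates (square G) F P
      P-sep = closed⇒separates F P closed
      inP : Interior P
      inP = interior-of-side P P-sep p p∈P
      inQ : Interior (not ∘ P)
      inQ = interior-of-side (not ∘ P) (separates-complement F P P-sep) q (cong not q∉P)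
      open Interior
      C : Crossing G P
      C = crossing G P (conn (center inP) (center inQ)) (center∈ inP) (neighbours∈ inP)
            (not-true (center∈ inQ)) (λ v wv → not-true (neighbours∈ inQ v wv))
      2δ≤d : 2 * δ ≤ d
      2δ≤d = ≤-trans (crossing-bound G P δ (minDegree≤count G) C)
                     (≤-trans (+-monoˡ-≤ 1 (cutSize≤edgeCount (square G) F P P-sep))
                              (≤-trans (≤-reflexive (+-comm (edgeCount F) 1)) F<δ²))

theorem2 : ∀ {m} (G : Graph (suc m)) → Connected G
           → (suc m + 2) / 4 ≤ minDegree G
           → MaximallyEdgeConnected (square G)
theorem2 {m} G conn δ-bound = every-disconnecting-set-is-large , star-of-minimum-degree-vertex
  where
  every-disconnecting-set-is-large : ∀ F → ¬ Connected (square G ─ F) → minDegree (square G) ≤ edgeCount F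
  every-disconnecting-set-is-large F ¬conn =
    ≮⇒≥ (λ F<δ² → small-cut-does-not-disconnect G F F<δ² conn δ-bound ¬conn)
  star-of-minimum-degree-vertex : 1 ≤ m →
    Σ (EdgeSet (square G)) λ F → ¬ Connected (square G ─ F) × edgeCount F ≡ minDegree (square G)
  star-of-minimum-degree-vertex 1≤m with minFin-attained (degree (square G))
  ... | c , δ²≡deg-c with other-vertex 1≤m c
  ...   | v , v≢c = star (square G) c , star-disconnects (square G) c v v≢c ,
                    trans (edgeCount-star (square G) c) (sym δ²≡deg-c)
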